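{- Let $\lambda$ and $\mu$ be partitions (not necessarily with $\mu\subseteq\lambda$), and let $\mathbf{b}=(b_1,b_2,\ldots)$ be the flagging induced by $\lambda/\mu$. Then the map $$\{i\ge1: m_i\notin\Delta(\lambda)\}\to\{p\ge1:\ell^t_p\notin\Delta(\mu^t)\},\qquad i\mapsto m_i+1+b_i$$ is well-defined and is a bijection.
   Context: $\ell_i=\lambda_i-i$, $m_i=\mu_i-i$, $\ell^t_i=\lambda^t_i-i$ for $i\ge1$, where $\lambda^t$ is the conjugate partition: $\lambda^t_k=|\{i\ge1:\lambda_i\ge k\}|$ (similarly $\mu^t$). $\Delta(\nu)=\{\nu_i-i:i\ge1\}$ for a partition $\nu$. The flagging induced by $\lambda/\mu$ is $b_i=\max\{k\ge0:\lambda_k-k\ge\mu_i-i\}$ with $\lambda_0=+\infty$. -}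

module Defs where

open import Data.Nat as ℕ using (ℕ; zero; suc; _≤_; _≥_; _≤?_)
open import Data.Integer as ℤ using (ℤ; +_)
open import Data.List using (List; []; _∷_; length; filter)
open import Data.List.Relation.Unary.Linked using (Linked)
open import Data.Product using (Σ; ∃; _×_; _,_)
open import Data.Sum using (_⊎_)
open import Relation.Binary.PropositionalEquality using (_≡_)

-- A partition is a weakly decreasing finite list of natural numbers
-- (trailing zeros allowed; they are harmless since parts beyond the
-- list are 0).
record Partition : Set where
  constructor mkPartition
  field
    parts : List ℕ
    decreasing : Linked _≥_ parts
open Partition public

-- 1-indexed parts: part ν i = ν_i for i ≥ 1 (0 beyond the length).
-- The value at index 0 is a dummy and never used.
partL : List ℕ → ℕ → ℕ
partL []       _             = 0
partL (x ∷ xs) zero          = 0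
partL (x ∷ xs) (suc zero)    = x
partL (x ∷ xs) (suc (suc i)) = partL xs (suc i)

part : Partition → ℕ → ℕ
part ν = partL (parts ν)

-- conjugate partition: ν^t_k = |{ i ≥ 1 : ν_i ≥ k }|  (used for k ≥ 1)
conj : Partition → ℕ → ℕ
conj ν k = length (filter (k ≤?_) (parts ν))

shift : (ℕ → ℕ) → ℕ → ℤ
shift ν i = + ν i ℤ.- + i

_∈Δ_ : ℤ → (ℕ → ℕ) → Set
x ∈Δ ν = ∃ λ i → 1 ≤ i × x ≡ shift ν i

-- membership of k in { k ≥ 0 : λ_k - k ≥ μ_i - i }, with λ_0 = +∞
InFlagSet : Partition → Partition → ℕ → ℕ → Set
InFlagSet lam mu i k = k ≡ 0 ⊎ (1 ≤ k × shift (part mu) i ℤ.≤ shift (part lam) k)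

IsFlagging : Partition → Partition → (ℕ → ℕ) → Set
IsFlagging lam mu b =
  ∀ i → 1 ≤ i → InFlagSet lam mu i (b i) × (∀ k → InFlagSet lam mu i k → k ≤ b i)

-- Conjugate sequences f, g (p ≤ f k ⇔ k ≤ g p, e.g. a partition and its conjugate) have
-- complementary shifted sets: every integer lies in exactly one of Δ(f) and -1 - Δ(g).
-- Indeed, an x outside Δ(f) falls in a gap f(c+1) - (c+1) < x < f c - c, and then
-- p = x + 1 + c has g p = c, that is g p - p = -1 - x.  For x = m_i ∉ Δ(λ) the gap index is
-- exactly the flag b_i, so i ↦ m_i + 1 + b_i sends i to the p with ℓᵗ_p = -1 - m_i.  This p
-- avoids Δ(μᵗ) because -1 - m_i ∈ -1 - Δ(μ); injectivity follows from that of i ↦ m_i, and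
-- surjectivity from the partition of ℤ for μ (giving i) and for λ (giving m_i ∉ Δ(λ)).
{-# OPTIONS --safe #-}
module Submission where

open import Defs
open import Data.Nat using (ℕ; _≤_)
open import Data.Integer using (ℤ; +_; _+_)
open import Data.Product using (∃; _×_)
open import Relation.Nullary using (¬_)
open import Relation.Binary.PropositionalEquality using (_≡_)

open import Algebra.Bundles using (AbelianGroup)
open import Data.Integer as ℤ using (-1ℤ; _-_; -_; ∣_∣; -[1+_])
import Data.Integer.Properties as ℤP
open import Data.Integer.Tactic.RingSolver using (solve-∀)
open import Data.List using (List; []; _∷_; length; filter)
open import Data.List.Properties using (filter-accept; filter-reject)
open import Data.List.Relation.Unary.Linked as Linked using (Linked; [-]; _∷_)
open import Data.Nat as ℕ using (zero; suc; z≤n; s≤s; _<_; _≥_; _≤?_)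
import Data.Nat.Properties as ℕP
open import Data.Product using (_,_)
open import Data.Sum using (inj₁; inj₂)
open import Relation.Binary.Definitions using (tri<; tri≈; tri>)
open import Relation.Binary.PropositionalEquality using (refl; sym; trans; cong; cong₂; subst; module ≡-Reasoning)
open import Relation.Nullary using (yes; no; contradiction)
open import Relation.Unary using (Decidable)

open import Algebra.Properties.Group (AbelianGroup.group ℤP.+-0-abelianGroup)
  using (∙-cancelˡ; ∙-cancelʳ; //-rightDividesˡ)

private variable
  f g : ℕ → ℕ
  i j k c p : ℕ
  x y z : ℤ

-- Only positive indices are constrained, as part ν 0 is a dummy value.
record Conjugate (f g : ℕ → ℕ) : Set where
  field
    ≤f⇒≤g : ∀ {p k} → 1 ≤ p → 1 ≤ k → p ≤ f k → k ≤ g p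
    ≤g⇒≤f : ∀ {p k} → 1 ≤ p → 1 ≤ k → k ≤ g p → p ≤ f k
open Conjugate

Conjugate-sym : Conjugate f g → Conjugate g f
Conjugate-sym fg = record
  { ≤f⇒≤g = λ 1≤p 1≤k → ≤g⇒≤f fg 1≤k 1≤p
  ; ≤g⇒≤f = λ 1≤p 1≤k → ≤f⇒≤g fg 1≤k 1≤p
  }

Antitone⁺ : (ℕ → ℕ) → Set
Antitone⁺ f = ∀ {i j} → 1 ≤ i → i ≤ j → f j ≤ f i

conjugate-antitone : Conjugate f g → Antitone⁺ f
conjugate-antitone {f} fg {i} {j} 1≤i i≤j with f j in fj≡
... | zero  = z≤n
... | suc a = ≤g⇒≤f fg (s≤s z≤n) 1≤i
  (ℕP.≤-trans i≤j (≤f⇒≤g fg (s≤s z≤n) (ℕP.≤-trans 1≤i i≤j) (ℕP.≤-reflexive (sym fj≡))))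

conjugate-value : Conjugate f g → 1 ≤ p → (1 ≤ c → p ≤ f c) → f (suc c) < p → g p ≡ c
conjugate-value {f} {g} {p} {c} fg 1≤p p≤fc fc+1<p = ℕP.≤-antisym gp≤c (c≤gp c p≤fc)
  where
  gp≤c : g p ≤ c
  gp≤c = ℕP.≮⇒≥ (λ c<gp → ℕP.<⇒≱ fc+1<p (≤g⇒≤f fg 1≤p (s≤s z≤n) c<gp))
  c≤gp : ∀ c → (1 ≤ c → p ≤ f c) → c ≤ g p
  c≤gp zero    _    = z≤n
  c≤gp (suc c) p≤fc = ≤f⇒≤g fg 1≤p (s≤s z≤n) (p≤fc (s≤s z≤n))

conjL : ℕ → List ℕ → ℕ
conjL p xs = length (filter (p ≤?_) xs)

partL-≤-head : ∀ {x xs} → Linked _≥_ (x ∷ xs) → ∀ k → partL (x ∷ xs) k ≤ x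
partL-≤-head _           zero          = z≤n
partL-≤-head _           (suc zero)    = ℕP.≤-refl
partL-≤-head [-]         (suc (suc k)) = z≤n
partL-≤-head (x≥y ∷ xs↓) (suc (suc k)) = ℕP.≤-trans (partL-≤-head xs↓ (suc k)) x≥y

conjL-accept : ∀ {p x} xs → p ≤ x → conjL p (x ∷ xs) ≡ suc (conjL p xs)
conjL-accept {p} xs p≤x = cong length (filter-accept (p ≤?_) {xs = xs} p≤x)

conjL-reject : ∀ {p x} xs → ¬ p ≤ x → conjL p (x ∷ xs) ≡ conjL p xs
conjL-reject {p} xs p≰x = cong length (filter-reject (p ≤?_) {xs = xs} p≰x)

head<⇒conjL≡0 : ∀ {x xs p} → Linked _≥_ (x ∷ xs) → x < p → conjL p xs ≡ 0
head<⇒conjL≡0 [-] _ = refl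
head<⇒conjL≡0 {xs = _ ∷ xs} (x≥y ∷ xs↓) x<p =
  trans (conjL-reject xs (ℕP.<⇒≱ y<p)) (head<⇒conjL≡0 xs↓ y<p)
  where y<p = ℕP.≤-<-trans x≥y x<p

≤partL⇒≤conjL : ∀ {xs} → Linked _≥_ xs → ∀ {p k} → 1 ≤ p → p ≤ partL xs k → k ≤ conjL p xs
≤partL⇒≤conjL _ {k = zero} _ _ = z≤n
≤partL⇒≤conjL {[]} _ {k = suc _} (s≤s z≤n) ()
≤partL⇒≤conjL {x ∷ xs} _ {k = suc zero} _ p≤x =
  subst (1 ≤_) (sym (conjL-accept xs p≤x)) (s≤s z≤n)
≤partL⇒≤conjL {x ∷ xs} xs↓ {k = suc (suc k)} 1≤p p≤ =
  subst (suc (suc k) ≤_) (sym (conjL-accept xs (ℕP.≤-trans p≤ (partL-≤-head xs↓ (suc (suc k))))))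
    (s≤s (≤partL⇒≤conjL (Linked.tail xs↓) 1≤p p≤))

≤conjL⇒≤partL : ∀ {xs} → Linked _≥_ xs → ∀ {p k} → 1 ≤ k → k ≤ conjL p xs → p ≤ partL xs k
≤conjL⇒≤partL {[]} _ (s≤s z≤n) ()
≤conjL⇒≤partL {x ∷ xs} xs↓ {p} {k} 1≤k k≤ with p ≤? x
... | no p≰x = contradiction
  (subst (k ≤_) (trans (conjL-reject xs p≰x) (head<⇒conjL≡0 xs↓ (ℕP.≰⇒> p≰x))) k≤)
  (ℕP.<⇒≱ 1≤k)
... | yes p≤x with k | subst (k ≤_) (conjL-accept xs p≤x) k≤
...   | suc zero     | _  = p≤x
...   | suc (suc k') | k≤′ = ≤conjL⇒≤partL (Linked.tail xs↓) (s≤s z≤n) (ℕ.s≤s⁻¹ k≤′)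

part-conj-conjugate : ∀ ν → Conjugate (part ν) (conj ν)
part-conj-conjugate ν = record
  { ≤f⇒≤g = λ 1≤p _ → ≤partL⇒≤conjL (decreasing ν) 1≤p
  ; ≤g⇒≤f = λ _ 1≤k → ≤conjL⇒≤partL (decreasing ν) 1≤k
  }

Complementary : ℤ → ℤ → Set
Complementary x y = x + y ≡ -1ℤ

complementary-uniqueˡ : Complementary x z → Complementary y z → x ≡ y
complementary-uniqueˡ {x} {z} {y} xz yz = ∙-cancelʳ z x y (trans xz (sym yz))

complementary-uniqueʳ : Complementary x y → Complementary x z → y ≡ z
complementary-uniqueʳ {x} {y} {z} xy xz = ∙-cancelˡ x y z (trans xy (sym xz))

complementary-sym : Complementary x y → Complementary y x
complementary-sym {x} {y} xy = trans (ℤP.+-comm y x) xy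

shift-strictly-antitone : Antitone⁺ f → 1 ≤ i → i < j → shift f j ℤ.< shift f i
shift-strictly-antitone f↓ 1≤i i<j =
  ℤP.+-mono-≤-< (ℤ.+≤+ (f↓ 1≤i (ℕP.<⇒≤ i<j))) (ℤP.neg-mono-< (ℤ.+<+ i<j))

shift-injective : Antitone⁺ f → 1 ≤ i → 1 ≤ j → shift f i ≡ shift f j → i ≡ j
shift-injective {i = i} {j} f↓ 1≤i 1≤j fi≡fj with ℕP.<-cmp i j
... | tri< i<j _ _ = contradiction (sym fi≡fj) (ℤP.<⇒≢ (shift-strictly-antitone f↓ 1≤i i<j))
... | tri≈ _ i≡j _ = i≡j
... | tri> _ _ j<i = contradiction fi≡fj (ℤP.<⇒≢ (shift-strictly-antitone f↓ 1≤j j<i))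

complementary-shifts-sum : Complementary (shift f k) (shift g j) → suc (f k ℕ.+ g j) ≡ k ℕ.+ j
complementary-shifts-sum {f} {k} {g} {j} fk+gj≡-1 = ℤP.+-injective (begin
  + 1 + (+ f k + + g j)                          ≡⟨ regroup (+ f k) (+ g j) (+ k) (+ j) ⟩
  shift f k + shift g j + + 1 + (+ k + + j)      ≡⟨ cong (λ s → s + + 1 + (+ k + + j)) fk+gj≡-1 ⟩
  -1ℤ + + 1 + (+ k + + j)                         ∎)
  where
  open ≡-Reasoning
  regroup : ∀ a c m n → + 1 + (a + c) ≡ (a - m) + (c - n) + + 1 + (m + n)
  regroup = solve-∀

conjugate-shifts-¬complementary : Conjugate f g → 1 ≤ k → 1 ≤ j → ¬ Complementary (shift f k) (shift g j)
conjugate-shifts-¬complementary {f} {g} {k} {j} fg 1≤k 1≤j c with complementary-shifts-sum {f} {k} {g} {j} c | j ≤? f k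
... | sum≡ | yes j≤fk = ℕP.<-irrefl refl (begin-strict
  f k ℕ.+ g j         <⟨ ℕP.n<1+n _ ⟩
  suc (f k ℕ.+ g j)   ≡⟨ sum≡ ⟩
  k ℕ.+ j             ≤⟨ ℕP.+-mono-≤ (≤f⇒≤g fg 1≤j 1≤k j≤fk) j≤fk ⟩
  g j ℕ.+ f k         ≡⟨ ℕP.+-comm (g j) (f k) ⟩
  f k ℕ.+ g j         ∎)
  where open ℕP.≤-Reasoning
... | sum≡ | no j≰fk = ℕP.<-irrefl refl (begin-strict
  k ℕ.+ j             ≡⟨ sym sum≡ ⟩
  suc (f k ℕ.+ g j)   ≡⟨ sym (ℕP.+-suc (f k) (g j)) ⟩
  f k ℕ.+ suc (g j)   <⟨ ℕP.+-mono-<-≤ (ℕP.≰⇒> j≰fk) gj<k ⟩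
  j ℕ.+ k             ≡⟨ ℕP.+-comm j k ⟩
  k ℕ.+ j             ∎)
  where
  open ℕP.≤-Reasoning
  gj<k : g j < k
  gj<k = ℕP.≰⇒> (λ k≤gj → j≰fk (≤g⇒≤f fg 1≤j 1≤k k≤gj))

[i-j]+j≡i : ∀ i j → i - j + j ≡ i
[i-j]+j≡i i j = //-rightDividesˡ j i

-<⇒<+ : ∀ {i j k} → i - j ℤ.< k → i ℤ.< k + j
-<⇒<+ {i} {j} {k} i-j<k = subst (ℤ._< k + j) ([i-j]+j≡i i j) (ℤP.+-monoˡ-< j i-j<k)

<-⇒+< : ∀ {i j k} → k ℤ.< i - j → k + j ℤ.< i
<-⇒+< {i} {j} {k} k<i-j = subst (k + j ℤ.<_) ([i-j]+j≡i i j) (ℤP.+-monoˡ-< j k<i-j)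

-- f 0 - 0 counts as +∞, as λ_0 does in the flagging.
record InGap (f : ℕ → ℕ) (x : ℤ) (c : ℕ) : Set where
  field
    below : 1 ≤ c → x ℤ.< shift f c
    above : shift f (suc c) ℤ.< x

gap-lower : InGap f x c → + f (suc c) ℤ.< x + + 1 + + c
gap-lower {x = x} {c} gap =
  subst (_ ℤ.<_) (sym (ℤP.+-assoc x (+ 1) (+ c))) (-<⇒<+ (InGap.above gap))

gap-upper : InGap f x c → 1 ≤ c → x + + 1 + + c ℤ.≤ + f c
gap-upper {x = x} {c} gap 1≤c =
  subst (ℤ._≤ _) (reorder x (+ c)) (ℤP.i<j⇒suc[i]≤j (<-⇒+< (InGap.below gap 1≤c)))
  where
  reorder : ∀ x c → + 1 + (x + c) ≡ x + + 1 + c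
  reorder = solve-∀

+<⇒≡+ : ∀ {n w} → + n ℤ.< w → ∃ λ p → w ≡ + p × n < p
+<⇒≡+ {w = + p} (ℤ.+<+ n<p) = p , refl , n<p

gap-complementary : Conjugate f g → InGap f x c →
  ∃ λ p → 1 ≤ p × x + + 1 + + c ≡ + p × Complementary x (shift g p)
gap-complementary {f} {g} {x} {c} fg gap with +<⇒≡+ (gap-lower gap)
... | p , w≡p , fc+1<p = p , 1≤p , w≡p , x+ℓp≡-1
  where
  open ≡-Reasoning
  1≤p : 1 ≤ p
  1≤p = ℕP.<-≤-trans (s≤s z≤n) fc+1<p
  p≤fc : 1 ≤ c → p ≤ f c
  p≤fc 1≤c = ℤP.drop‿+≤+ (subst (ℤ._≤ + f c) w≡p (gap-upper gap 1≤c))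
  cancel : ∀ x c → x + (c - (x + + 1 + c)) ≡ - + 1
  cancel = solve-∀
  x+ℓp≡-1 : Complementary x (shift g p)
  x+ℓp≡-1 = begin
    x + (+ g p - + p)            ≡⟨ cong₂ (λ a b → x + (+ a - b)) (conjugate-value fg 1≤p p≤fc fc+1<p) (sym w≡p) ⟩
    x + (+ c - (x + + 1 + + c))  ≡⟨ cancel x (+ c) ⟩
    -1ℤ                          ∎

boundary : {P : ℕ → Set} → Decidable P → P 0 → ∀ n → ¬ P n → ∃ λ c → P c × ¬ P (suc c)
boundary P? P0 zero    ¬P0   = contradiction P0 ¬P0
boundary P? P0 (suc n) ¬Pn+1 with P? n
... | yes Pn = n , Pn , ¬Pn+1
... | no ¬Pn = boundary P? P0 n ¬Pn

m<i+[1+m+∣i∣] : ∀ m i → + m ℤ.< i + + suc (m ℕ.+ ∣ i ∣)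
m<i+[1+m+∣i∣] m (+ n)    = ℤ.+<+ (ℕP.≤-trans (s≤s (ℕP.m≤m+n m n)) (ℕP.m≤n+m _ n))
m<i+[1+m+∣i∣] m -[1+ n ] = subst (+ m ℤ.<_) (sym (cancel (+ suc n) (+ m))) (ℤ.+<+ ℕP.≤-refl)
  where
  cancel : ∀ s a → - s + (+ 1 + a + s) ≡ + 1 + a
  cancel = solve-∀

∉Δ⇒complementary : Conjugate f g → ¬ (y ∈Δ f) → ∃ λ p → 1 ≤ p × Complementary y (shift g p)
∉Δ⇒complementary {f} {g} {y} fg y∉Δ with boundary P? (λ ()) N ¬PN
  where
  P : ℕ → Set
  P c = 1 ≤ c → y ℤ.< shift f c
  P? : Decidable P
  P? zero = yes (λ ())
  P? (suc c) with y ℤP.<? shift f (suc c)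
  ... | yes y< = yes (λ _ → y<)
  ... | no  y≮ = no (λ P → y≮ (P (s≤s z≤n)))
  N : ℕ
  N = suc (f 1 ℕ.+ ∣ y ∣)
  ¬PN : ¬ P N
  ¬PN y<fN = ℤP.<-asym (m<i+[1+m+∣i∣] (f 1) y)
    (ℤP.<-≤-trans (<-⇒+< (y<fN (s≤s z≤n))) (ℤ.+≤+ (conjugate-antitone fg (s≤s z≤n) (s≤s z≤n))))
... | c , Pc , ¬Pc+1 with ℤP.<-cmp (shift f (suc c)) y
...   | tri< fc+1<y _ _ = let p , 1≤p , _ , y+ℓp≡-1 = gap-complementary fg (record { below = Pc ; above = fc+1<y })
                          in p , 1≤p , y+ℓp≡-1
...   | tri≈ _ fc+1≡y _ = contradiction (suc c , s≤s z≤n , sym fc+1≡y) y∉Δ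
...   | tri> _ _ y<fc+1 = contradiction (λ _ → y<fc+1) ¬Pc+1

complementary⇒∉Δ : Conjugate f g → 1 ≤ p → Complementary x (shift g p) → ¬ (x ∈Δ f)
complementary⇒∉Δ {g = g} {p} fg 1≤p x+ℓp≡-1 (k , 1≤k , x≡ℓk) =
  conjugate-shifts-¬complementary fg 1≤k 1≤p (subst (λ t → Complementary t (shift g p)) x≡ℓk x+ℓp≡-1)

flagging-gap : ∀ {lam mu b i} → IsFlagging lam mu b → 1 ≤ i →
  ¬ (shift (part mu) i ∈Δ part lam) → InGap (part lam) (shift (part mu) i) (b i)
flagging-gap {lam} {mu} {b} {i} flag 1≤i m∉Δ with flag i 1≤i
... | b∈flags , b-maximal = record { below = below b∈flags ; above = above }
  where
  below : InFlagSet lam mu i (b i) → 1 ≤ b i → shift (part mu) i ℤ.< shift (part lam) (b i)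
  below (inj₁ b≡0)       1≤b = contradiction (subst (1 ≤_) b≡0 1≤b) (λ ())
  below (inj₂ (_ , m≤ℓ)) 1≤b = ℤP.≤∧≢⇒< m≤ℓ (λ m≡ℓ → m∉Δ (b i , 1≤b , m≡ℓ))
  above : shift (part lam) (suc (b i)) ℤ.< shift (part mu) i
  above = ℤP.≰⇒> (λ m≤ℓ → ℕP.<-irrefl refl (b-maximal (suc (b i)) (inj₂ (s≤s z≤n , m≤ℓ))))

lemma13p5 : (lam mu : Partition) (b : ℕ → ℕ) → IsFlagging lam mu b →
    ((∀ i → 1 ≤ i → ¬ (shift (part mu) i ∈Δ part lam) →
        ∃ λ p → 1 ≤ p × shift (part mu) i + + 1 + + b i ≡ + p
          × ¬ (shift (conj lam) p ∈Δ conj mu))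
    × (∀ i j → 1 ≤ i → ¬ (shift (part mu) i ∈Δ part lam) →
        1 ≤ j → ¬ (shift (part mu) j ∈Δ part lam) →
        shift (part mu) i + + 1 + + b i ≡ shift (part mu) j + + 1 + + b j → i ≡ j)
    × (∀ p → 1 ≤ p → ¬ (shift (conj lam) p ∈Δ conj mu) →
        ∃ λ i → 1 ≤ i × ¬ (shift (part mu) i ∈Δ part lam)
          × shift (part mu) i + + 1 + + b i ≡ + p))
lemma13p5 lam mu b flag = well-defined , injective , surjective
  where
  λλᵗ = part-conj-conjugate lam
  μμᵗ = part-conj-conjugate mu
  m = shift (part mu)
  ℓᵗ = shift (conj lam)

  image : ∀ {i} → 1 ≤ i → ¬ (m i ∈Δ part lam) →
    ∃ λ p → 1 ≤ p × m i + + 1 + + b i ≡ + p × Complementary (m i) (ℓᵗ p)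
  image 1≤i mi∉Δ = gap-complementary λλᵗ (flagging-gap {lam} {mu} {b} flag 1≤i mi∉Δ)

  well-defined = λ i 1≤i mi∉Δ → let p , 1≤p , i↦p , mi+ℓp≡-1 = image 1≤i mi∉Δ in
    p , 1≤p , i↦p , complementary⇒∉Δ (Conjugate-sym μμᵗ) 1≤i (complementary-sym {m i} mi+ℓp≡-1)

  injective = λ i j 1≤i mi∉Δ 1≤j mj∉Δ i↦≡j↦ →
    let p , _ , i↦p , mi+ℓp≡-1 = image 1≤i mi∉Δ
        q , _ , j↦q , mj+ℓq≡-1 = image 1≤j mj∉Δ
        p≡q = ℤP.+-injective (trans (sym i↦p) (trans i↦≡j↦ j↦q))
    in shift-injective (conjugate-antitone μμᵗ) 1≤i 1≤j
         (complementary-uniqueˡ mi+ℓp≡-1 (subst (λ r → Complementary (m j) (ℓᵗ r)) (sym p≡q) mj+ℓq≡-1))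

  surjective = λ p 1≤p ℓp∉Δ →
    let i , 1≤i , ℓp+mi≡-1 = ∉Δ⇒complementary (Conjugate-sym μμᵗ) ℓp∉Δ
        mi+ℓp≡-1 = complementary-sym {ℓᵗ p} ℓp+mi≡-1
        mi∉Δ = complementary⇒∉Δ λλᵗ 1≤p mi+ℓp≡-1
        p′ , 1≤p′ , i↦p′ , mi+ℓp′≡-1 = image 1≤i mi∉Δ
        p′≡p = shift-injective (conjugate-antitone (Conjugate-sym λλᵗ)) 1≤p′ 1≤p
                 (complementary-uniqueʳ {m i} mi+ℓp′≡-1 mi+ℓp≡-1)
    in i , 1≤i , mi∉Δ , trans i↦p′ (cong +_ p′≡p)
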